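{- Let $\mathcal M=(R,D,C)$ be any $\lambda\mu$-model in the category of $\omega$-algebraic lattices, and consider the intersection type system and type interpretation defined below (with types built over the compact elements of $R$). If $\Gamma\vdash T:\sigma\mid\Delta$ is derivable, then $\Gamma\models_{\mathcal M}T:\sigma\mid\Delta$.
   Context: Syntax. $\lambda\mu$-terms are $M::=x\mid\lambda x.M\mid MN\mid\mu\alpha.c$ and commands are $c::=[\alpha]M$; $T$ ranges over both. Model. A $\lambda\mu$-model consists of $\omega$-algebraic lattices $R,D,C$ with $D\cong[C\to R]$ (Scott-continuous maps) and $C\cong D\times C$. The isomorphisms are implicit; $d\,k$ denotes application and $\langle d,k\rangle$ pairing. An environment $e$ maps variables to $D$ and names to $C$. Interpretation: - $[\![x]\!]e=e(x)$; - $[\![\lambda x.M]\!]e\langle d,k\rangle=[\![M]\!]e[x\mapsto d]\,k$; - $[\![MN]\!]e\,k=[\![M]\!]e\langle[\![N]\!]e,k\rangle$; - $[\![\mu\alpha.c]\!]e\,k=d\,k'$ where $\langle d,k'\rangle=[\![c]\!]e[\alpha\mapsto k]$; - $[\![[\alpha]M]\!]e=\langle[\![M]\!]e,e(\alpha)\rangle$. Types: - $\rho::=\psi_a\mid\omega\mid\rho\wedge\rho$ with $a$ compact in $R$; - $\delta::=\rho\mid\kappa\to\rho\mid\omega\mid\delta\wedge\delta$; - $\kappa::=\delta\times\kappa\mid\omega\mid\kappa\wedge\kappa$. Preorders. $\le_R,\le_D,\le_C$ are the least preorders such that: - in each sort $\wedge$ is meet and $\omega$ top; - $\psi_\bot\sim\omega$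 and $\psi_{a\sqcup b}\sim\psi_a\wedge\psi_b$; - $\rho_1\le_R\rho_2\Rightarrow\rho_1\le_D\rho_2$; - $\omega\le_D\omega\to\omega$, $\psi_a\le_D\omega\to\psi_a$, $\omega\to\psi_a\le_D\psi_a$, $\omega\le_C\omega\times\omega$; - $(\kappa\to\rho_1)\wedge(\kappa\to\rho_2)\le_D\kappa\to(\rho_1\wedge\rho_2)$; - $(\delta_1\times\kappa_1)\wedge(\delta_2\times\kappa_2)\le_C(\delta_1\wedge\delta_2)\times(\kappa_1\wedge\kappa_2)$; - $\to$ is contravariant on the left and covariant on the right; $\times$ is covariant. Type system. A basis $\Gamma$ is a finite map from variables to $\delta$-types and a context $\Delta$ a finite map from names to $\kappa$-types; missing entries are read as $\omega$. Rules: - (Ax) $\Gamma,x{:}\delta\vdash x:\delta\mid\Delta$; - ($\lambda$) from $\Gamma\vdash M:\kappa\to\rho\mid\Delta$ infer $\Gamma\setminus x\vdash\lambda x.M:\Gamma(x)\times\kappa\to\rho\mid\Delta$; - (App) from $M:\delta\times\kappa\to\rho$ and $N:\delta$ infer $MN:\kappa\to\rho$; - (cmd) from $\Gamma\vdash M:\delta\mid\Delta$ infer $\Gamma\vdash[\alpha]M:\delta\times\Delta(\alpha)\mid\Delta$; - ($\mu$) from $\Gamma\vdash c:(\kappa'\to\rho)\times\kappa'\mid\Delta$ infer $\Gamma\vdash\mu\alpha.c:\Delta(\alpha)\to\rho\mid\Delta\setminus\alpha$; - ($\wedge$), ($\omega$) $\Gamma\vdash T:\omega\mid\Delta$, and ($\le$)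 subsumption. Type interpretation: - $[\![\psi_a]\!]^R=\{r\mid a\sqsubseteq r\}$; - $[\![\delta\times\kappa]\!]^C=[\![\delta]\!]^D\times[\![\kappa]\!]^C$; - $[\![\kappa\to\rho]\!]^D=\{d\mid\forall k\in[\![\kappa]\!]^C,\ d\,k\in[\![\rho]\!]^R\}$; - $[\![\psi_a]\!]^D=\{d\mid\forall k\in C,\ d\,k\in[\![\psi_a]\!]^R\}$; - $[\![\omega]\!]^A=A$ and $[\![\sigma\wedge\tau]\!]^A=[\![\sigma]\!]^A\cap[\![\tau]\!]^A$. Satisfaction: - $e\models\Gamma;\Delta$ iff $e(x)\in[\![\Gamma(x)]\!]^D$ for all $x$ and $e(\alpha)\in[\![\Delta(\alpha)]\!]^C$ for all $\alpha$; - $\Gamma\models_{\mathcal M}T:\sigma\mid\Delta$ iff for every $e$ with $e\models\Gamma;\Delta$ one has $[\![T]\!]e\in[\![\sigma]\!]$ (in $D$ for terms, in $C$ for commands). -}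

module Defs where

open import Level using (Level)
open import Data.Nat using (ℕ; _≟_)
open import Data.Product using (Σ; ∃; _×_; _,_)
open import Data.Unit using (⊤)
open import Data.Empty using (⊥)
open import Data.Sum using (_⊎_)
open import Relation.Nullary using (yes; no)
open import Relation.Binary.PropositionalEquality using (_≡_)

record CompleteLattice : Set₁ where
  field
    Carrier   : Set
    _⊑_       : Carrier → Carrier → Set
    ⊑-refl    : ∀ x → x ⊑ x
    ⊑-trans   : ∀ {x y z} → x ⊑ y → y ⊑ z → x ⊑ z
    ⊑-antisym : ∀ {x y} → x ⊑ y → y ⊑ x → x ≡ y
    ⋁         : (Carrier → Set) → Carrier
    ⋁-upper   : ∀ S x → S x → x ⊑ ⋁ S
    ⋁-least   : ∀ S y → (∀ x → S x → x ⊑ y) → ⋁ S ⊑ y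

module _ (L : CompleteLattice) where
  open CompleteLattice L

  Directed : (Carrier → Set) → Set
  Directed S = (∃ λ x → S x)
             × (∀ x y → S x → S y → ∃ λ z → S z × x ⊑ z × y ⊑ z)

  IsCompact : Carrier → Set₁
  IsCompact a = ∀ S → Directed S → a ⊑ ⋁ S → ∃ λ x → S x × a ⊑ x

  bot : Carrier
  bot = ⋁ (λ _ → ⊥)

  _⊔_ : Carrier → Carrier → Carrier
  a ⊔ b = ⋁ (λ x → x ≡ a ⊎ x ≡ b)

  record IsOmegaAlgebraic : Set₁ where
    field
      enum         : ℕ → Carrier
      enum-compact : ∀ n → IsCompact (enum n)
      enum-onto    : ∀ c → IsCompact c → ∃ λ n → enum n ≡ c
      -- every element is the join of the compact elements below it
      -- (the set of compacts is written via the enumeration, for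
      --  predicativity reasons: IsCompact lives in Set₁)
      algebraic    : ∀ x → x ≡ ⋁ (λ c → (∃ λ n → enum n ≡ c) × c ⊑ x)

ScottContinuous : (A B : CompleteLattice) →
                  (CompleteLattice.Carrier A → CompleteLattice.Carrier B) → Set₁
ScottContinuous A B f =
  ∀ S → Directed A S →
    f (CompleteLattice.⋁ A S)
      ≡ CompleteLattice.⋁ B (λ y → ∃ λ x → S x × f x ≡ y)

-- λμ-models:  D ≅ [C → R],  C ≅ D × C  (isomorphisms of ω-algebraic
-- lattices, given as order isomorphisms)

record LambdaMuModel : Set₂ where
  field
    R D C : CompleteLattice
    R-ωalg : IsOmegaAlgebraic R
    D-ωalg : IsOmegaAlgebraic D
    C-ωalg : IsOmegaAlgebraic C

  open CompleteLattice R renaming (Carrier to |R|; _⊑_ to _⊑R_) public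
  open CompleteLattice D renaming (Carrier to |D|; _⊑_ to _⊑D_) public
  open CompleteLattice C renaming (Carrier to |C|; _⊑_ to _⊑C_) public

  field
    app      : |D| → |C| → |R|
    app-cont : ∀ d → ScottContinuous C R (app d)
    lam      : (f : |C| → |R|) → ScottContinuous C R f → |D|
    app-lam  : ∀ f p k → app (lam f p) k ≡ f k
    lam-app  : ∀ d → lam (app d) (app-cont d) ≡ d
    app-mono : ∀ {d d'} → d ⊑D d' → ∀ k → app d k ⊑R app d' k
    app-refl : ∀ {d d'} → (∀ k → app d k ⊑R app d' k) → d ⊑D d'
    pair      : |D| → |C| → |C|
    fst       : |C| → |D|
    snd       : |C| → |C|
    fst-pair  : ∀ d k → fst (pair d k) ≡ d
    snd-pair  : ∀ d k → snd (pair d k) ≡ k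
    pair-η    : ∀ k → pair (fst k) (snd k) ≡ k
    pair-mono : ∀ {k k'} → k ⊑C k' → fst k ⊑D fst k' × snd k ⊑C snd k'
    pair-refl : ∀ {k k'} → fst k ⊑D fst k' → snd k ⊑C snd k' → k ⊑C k'

update : ∀ {a} {A : Set a} → (ℕ → A) → ℕ → A → ℕ → A
update f x a y with y ≟ x
... | yes _ = a
... | no  _ = f y

data Term : Set
data Cmd  : Set

data Term where
  var : ℕ → Term
  ƛ   : ℕ → Term → Term
  _·_ : Term → Term → Term
  μ   : ℕ → Cmd → Term

data Cmd where
  [_]_ : ℕ → Term → Cmd

module _ (M : LambdaMuModel) where
  open LambdaMuModel M

  record Env : Set where
    constructor env
    field
      vars  : ℕ → |D|
      names : ℕ → |C|
  open Env public

  _[_↦ᵛ_] : Env → ℕ → |D| → Env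
  e [ x ↦ᵛ d ] = env (update (vars e) x d) (names e)

  _[_↦ⁿ_] : Env → ℕ → |C| → Env
  e [ α ↦ⁿ k ] = env (vars e) (update (names e) α k)

  -- The interpretation of terms and commands: any pair of maps satisfying
  -- the defining clauses of the paper (these clauses determine it uniquely,
  -- since elements of D are determined by their application behaviour).
  record Interpretation : Set where
    field
      ⟦_⟧t : Term → Env → |D|
      ⟦_⟧c : Cmd → Env → |C|
      ⟦var⟧ : ∀ x e → ⟦ var x ⟧t e ≡ vars e x
      ⟦ƛ⟧   : ∀ x N e d k →
              app (⟦ ƛ x N ⟧t e) (pair d k) ≡ app (⟦ N ⟧t (e [ x ↦ᵛ d ])) k
      ⟦·⟧   : ∀ N P e k →
              app (⟦ N · P ⟧t e) k ≡ app (⟦ N ⟧t e) (pair (⟦ P ⟧t e) k)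
      ⟦μ⟧   : ∀ α c e k →
              app (⟦ μ α c ⟧t e) k
                ≡ app (fst (⟦ c ⟧c (e [ α ↦ⁿ k ]))) (snd (⟦ c ⟧c (e [ α ↦ⁿ k ])))
      ⟦cmd⟧ : ∀ α N e → ⟦ [ α ] N ⟧c e ≡ pair (⟦ N ⟧t e) (names e α)

  data TyR : Set₁ where
    ψ   : (a : |R|) → IsCompact R a → TyR
    ω   : TyR
    _∧_ : TyR → TyR → TyR

  data TyD : Set₁
  data TyC : Set₁

  data TyD where
    ψ   : (a : |R|) → IsCompact R a → TyD
    _⇒_ : TyC → TyR → TyD
    ω   : TyD
    _∧_ : TyD → TyD → TyD

  data TyC where
    _⊗_ : TyD → TyC → TyC
    ω   : TyC
    _∧_ : TyC → TyC → TyC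

  ι : TyR → TyD
  ι (ψ a p)   = ψ a p
  ι ω         = ω
  ι (ρ ∧ ρ')  = ι ρ ∧ ι ρ'

  data _≤R_ : TyR → TyR → Set₁ where
    refl   : ∀ {ρ} → ρ ≤R ρ
    trans  : ∀ {ρ₁ ρ₂ ρ₃} → ρ₁ ≤R ρ₂ → ρ₂ ≤R ρ₃ → ρ₁ ≤R ρ₃
    ∧-lb₁  : ∀ {ρ₁ ρ₂} → (ρ₁ ∧ ρ₂) ≤R ρ₁
    ∧-lb₂  : ∀ {ρ₁ ρ₂} → (ρ₁ ∧ ρ₂) ≤R ρ₂
    ∧-glb  : ∀ {ρ ρ₁ ρ₂} → ρ ≤R ρ₁ → ρ ≤R ρ₂ → ρ ≤R (ρ₁ ∧ ρ₂)
    ω-top  : ∀ {ρ} → ρ ≤R ω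
    ψ⊥≤ω   : ∀ c p → c ≡ bot R → ψ c p ≤R ω
    ω≤ψ⊥   : ∀ c p → c ≡ bot R → ω ≤R ψ c p
    ψ⊔≤    : ∀ a b c pa pb pc → c ≡ _⊔_ R a b → ψ c pc ≤R (ψ a pa ∧ ψ b pb)
    ψ⊔≥    : ∀ a b c pa pb pc → c ≡ _⊔_ R a b → (ψ a pa ∧ ψ b pb) ≤R ψ c pc

  data _≤D_ : TyD → TyD → Set₁
  data _≤C_ : TyC → TyC → Set₁

  data _≤D_ where
    refl   : ∀ {δ} → δ ≤D δ
    trans  : ∀ {δ₁ δ₂ δ₃} → δ₁ ≤D δ₂ → δ₂ ≤D δ₃ → δ₁ ≤D δ₃
    ∧-lb₁  : ∀ {δ₁ δ₂} → (δ₁ ∧ δ₂) ≤D δ₁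
    ∧-lb₂  : ∀ {δ₁ δ₂} → (δ₁ ∧ δ₂) ≤D δ₂
    ∧-glb  : ∀ {δ δ₁ δ₂} → δ ≤D δ₁ → δ ≤D δ₂ → δ ≤D (δ₁ ∧ δ₂)
    ω-top  : ∀ {δ} → δ ≤D ω
    ψ⊥≤ω   : ∀ c p → c ≡ bot R → ψ c p ≤D ω
    ω≤ψ⊥   : ∀ c p → c ≡ bot R → ω ≤D ψ c p
    ψ⊔≤    : ∀ a b c pa pb pc → c ≡ _⊔_ R a b → ψ c pc ≤D (ψ a pa ∧ ψ b pb)
    ψ⊔≥    : ∀ a b c pa pb pc → c ≡ _⊔_ R a b → (ψ a pa ∧ ψ b pb) ≤D ψ c pc
    R⇒D    : ∀ {ρ₁ ρ₂} → ρ₁ ≤R ρ₂ → ι ρ₁ ≤D ι ρ₂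
    ω≤ω⇒ω  : ω ≤D (ω ⇒ ω)
    ψ≤ω⇒ψ  : ∀ a p → ψ a p ≤D (ω ⇒ ψ a p)
    ω⇒ψ≤ψ  : ∀ a p → (ω ⇒ ψ a p) ≤D ψ a p
    ⇒-∧    : ∀ {κ ρ₁ ρ₂} → ((κ ⇒ ρ₁) ∧ (κ ⇒ ρ₂)) ≤D (κ ⇒ (ρ₁ ∧ ρ₂))
    ⇒-mono : ∀ {κ κ' ρ ρ'} → κ' ≤C κ → ρ ≤R ρ' → (κ ⇒ ρ) ≤D (κ' ⇒ ρ')

  data _≤C_ where
    refl   : ∀ {κ} → κ ≤C κ
    trans  : ∀ {κ₁ κ₂ κ₃} → κ₁ ≤C κ₂ → κ₂ ≤C κ₃ → κ₁ ≤C κ₃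
    ∧-lb₁  : ∀ {κ₁ κ₂} → (κ₁ ∧ κ₂) ≤C κ₁
    ∧-lb₂  : ∀ {κ₁ κ₂} → (κ₁ ∧ κ₂) ≤C κ₂
    ∧-glb  : ∀ {κ κ₁ κ₂} → κ ≤C κ₁ → κ ≤C κ₂ → κ ≤C (κ₁ ∧ κ₂)
    ω-top  : ∀ {κ} → κ ≤C ω
    ω≤ω⊗ω  : ω ≤C (ω ⊗ ω)
    ⊗-∧    : ∀ {δ₁ δ₂ κ₁ κ₂} →
             ((δ₁ ⊗ κ₁) ∧ (δ₂ ⊗ κ₂)) ≤C ((δ₁ ∧ δ₂) ⊗ (κ₁ ∧ κ₂))
    ⊗-mono : ∀ {δ δ' κ κ'} → δ ≤D δ' → κ ≤C κ' → (δ ⊗ κ) ≤C (δ' ⊗ κ')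

  -- Bases and contexts: maps from variables/names to types
  -- (entries not explicitly given are ω)

  Basis : Set₁
  Basis = ℕ → TyD

  Context : Set₁
  Context = ℕ → TyC

  _∖ᵛ_ : Basis → ℕ → Basis
  Γ ∖ᵛ x = update Γ x ω

  _∖ⁿ_ : Context → ℕ → Context
  Δ ∖ⁿ α = update Δ α ω

  data _⊢t_∶_∣_ : Basis → Term → TyD → Context → Set₁
  data _⊢c_∶_∣_ : Basis → Cmd → TyC → Context → Set₁

  data _⊢t_∶_∣_ where
    Ax  : ∀ {Γ Δ} x → Γ ⊢t var x ∶ Γ x ∣ Δ
    Lam : ∀ {Γ Δ x N κ ρ} → Γ ⊢t N ∶ (κ ⇒ ρ) ∣ Δ →
          (Γ ∖ᵛ x) ⊢t ƛ x N ∶ ((Γ x ⊗ κ) ⇒ ρ) ∣ Δ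
    App : ∀ {Γ Δ N P δ κ ρ} → Γ ⊢t N ∶ ((δ ⊗ κ) ⇒ ρ) ∣ Δ →
          Γ ⊢t P ∶ δ ∣ Δ → Γ ⊢t N · P ∶ (κ ⇒ ρ) ∣ Δ
    Mu  : ∀ {Γ Δ α c κ' ρ} → Γ ⊢c c ∶ ((κ' ⇒ ρ) ⊗ κ') ∣ Δ →
          Γ ⊢t μ α c ∶ (Δ α ⇒ ρ) ∣ (Δ ∖ⁿ α)
    Meet : ∀ {Γ Δ N δ₁ δ₂} → Γ ⊢t N ∶ δ₁ ∣ Δ → Γ ⊢t N ∶ δ₂ ∣ Δ →
           Γ ⊢t N ∶ (δ₁ ∧ δ₂) ∣ Δ
    Top : ∀ {Γ Δ N} → Γ ⊢t N ∶ ω ∣ Δ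
    Sub : ∀ {Γ Δ N δ δ'} → Γ ⊢t N ∶ δ ∣ Δ → δ ≤D δ' → Γ ⊢t N ∶ δ' ∣ Δ

  data _⊢c_∶_∣_ where
    Com  : ∀ {Γ Δ α N δ} → Γ ⊢t N ∶ δ ∣ Δ →
           Γ ⊢c [ α ] N ∶ (δ ⊗ Δ α) ∣ Δ
    Meet : ∀ {Γ Δ c κ₁ κ₂} → Γ ⊢c c ∶ κ₁ ∣ Δ → Γ ⊢c c ∶ κ₂ ∣ Δ →
           Γ ⊢c c ∶ (κ₁ ∧ κ₂) ∣ Δ
    Top  : ∀ {Γ Δ c} → Γ ⊢c c ∶ ω ∣ Δ
    Sub  : ∀ {Γ Δ c κ κ'} → Γ ⊢c c ∶ κ ∣ Δ → κ ≤C κ' → Γ ⊢c c ∶ κ' ∣ Δ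

  ⟦_⟧R : TyR → |R| → Set
  ⟦ ψ a _ ⟧R r  = a ⊑R r
  ⟦ ω ⟧R r      = ⊤
  ⟦ ρ ∧ ρ' ⟧R r = ⟦ ρ ⟧R r × ⟦ ρ' ⟧R r

  ⟦_⟧D : TyD → |D| → Set
  ⟦_⟧C : TyC → |C| → Set

  ⟦ ψ a _ ⟧D d  = ∀ k → a ⊑R app d k
  ⟦ κ ⇒ ρ ⟧D d  = ∀ k → ⟦ κ ⟧C k → ⟦ ρ ⟧R (app d k)
  ⟦ ω ⟧D d      = ⊤
  ⟦ δ ∧ δ' ⟧D d = ⟦ δ ⟧D d × ⟦ δ' ⟧D d

  ⟦ δ ⊗ κ ⟧C k  = ⟦ δ ⟧D (fst k) × ⟦ κ ⟧C (snd k)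
  ⟦ ω ⟧C k      = ⊤
  ⟦ κ ∧ κ' ⟧C k = ⟦ κ ⟧C k × ⟦ κ' ⟧C k

  _⊨_︔_ : Env → Basis → Context → Set
  e ⊨ Γ ︔ Δ = (∀ x → ⟦ Γ x ⟧D (vars e x)) × (∀ α → ⟦ Δ α ⟧C (names e α))

  module _ (I : Interpretation) where
    open Interpretation I

    _⊨t_∶_∣_ : Basis → Term → TyD → Context → Set
    Γ ⊨t N ∶ δ ∣ Δ = ∀ e → e ⊨ Γ ︔ Δ → ⟦ δ ⟧D (⟦ N ⟧t e)

    _⊨c_∶_∣_ : Basis → Cmd → TyC → Context → Set
    Γ ⊨c c ∶ κ ∣ Δ = ∀ e → e ⊨ Γ ︔ Δ → ⟦ κ ⟧C (⟦ c ⟧c e)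

-- Each preorder axiom is valid in the
-- model: the ψ-axioms are the lattice laws of ⊥ and ⊔ in R, the remaining ones
-- are pointwise consequences of D ≅ [C → R] and C ≅ D × C. The typing rules then mirror the defining clauses of
-- the interpretation, the (λ) and (μ) rules extending the environment at the bound
-- variable or name.
module Submission where

open import Defs
open import Data.Nat using (ℕ; _≟_)
open import Data.Product using (_×_; _,_; proj₁; proj₂)
open import Data.Unit using (tt)
open import Data.Sum using (inj₁; inj₂)
open import Relation.Nullary using (yes; no)
open import Relation.Binary.PropositionalEquality using (_≡_; refl; sym; subst)

module _ (L : CompleteLattice) where
  open CompleteLattice L

  bot-least : ∀ x → bot L ⊑ x
  bot-least x = ⋁-least _ x (λ _ ())

  x⊑x⊔y : ∀ x y → x ⊑ _⊔_ L x y
  x⊑x⊔y x y = ⋁-upper _ x (inj₁ refl)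

  y⊑x⊔y : ∀ x y → y ⊑ _⊔_ L x y
  y⊑x⊔y x y = ⋁-upper _ y (inj₂ refl)

  ⊔-least : ∀ {x y z} → x ⊑ z → y ⊑ z → _⊔_ L x y ⊑ z
  ⊔-least {x} {y} {z} x⊑z y⊑z = ⋁-least _ z λ { _ (inj₁ refl) → x⊑z ; _ (inj₂ refl) → y⊑z }

pointwise-update : ∀ {a b ℓ} {A : Set a} {B : Set b} (P : A → B → Set ℓ)
                   (f : ℕ → A) (g : ℕ → B) x {a₀ b₀} →
                   (∀ y → P (update f x a₀ y) (g y)) → P (f x) b₀ →
                   ∀ y → P (f y) (update g x b₀ y)
pointwise-update P f g x hyp Pb₀ y with y ≟ x | hyp y
... | yes refl | _   = Pb₀
... | no _     | Pfy = Pfy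

module _ (M : LambdaMuModel) where
  open LambdaMuModel M

  ⟦ι⟧-elim : ∀ ρ {d} → ⟦_⟧D M (ι M ρ) d → ∀ k → ⟦_⟧R M ρ (app d k)
  ⟦ι⟧-elim (ψ a _)  h        k = h k
  ⟦ι⟧-elim ω        h        k = tt
  ⟦ι⟧-elim (ρ ∧ ρ') (h , h') k = ⟦ι⟧-elim ρ h k , ⟦ι⟧-elim ρ' h' k

  ⟦ι⟧-intro : ∀ ρ {d} → (∀ k → ⟦_⟧R M ρ (app d k)) → ⟦_⟧D M (ι M ρ) d
  ⟦ι⟧-intro (ψ a _)  h = h
  ⟦ι⟧-intro ω        h = tt
  ⟦ι⟧-intro (ρ ∧ ρ') h = ⟦ι⟧-intro ρ (λ k → proj₁ (h k)) , ⟦ι⟧-intro ρ' (λ k → proj₂ (h k))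

  ⟦⊗⟧-pair : ∀ {δ κ d k} → ⟦_⟧D M δ d → ⟦_⟧C M κ k → ⟦_⟧C M (δ ⊗ κ) (pair d k)
  ⟦⊗⟧-pair {δ} {κ} {d} {k} hd hk =
    subst (⟦_⟧D M δ) (sym (fst-pair d k)) hd , subst (⟦_⟧C M κ) (sym (snd-pair d k)) hk

  ≤R-sound : ∀ {ρ ρ'} → _≤R_ M ρ ρ' → ∀ {r} → ⟦_⟧R M ρ r → ⟦_⟧R M ρ' r
  ≤R-sound refl                    h         = h
  ≤R-sound (trans p q)             h         = ≤R-sound q (≤R-sound p h)
  ≤R-sound ∧-lb₁                   h         = proj₁ h
  ≤R-sound ∧-lb₂                   h         = proj₂ h
  ≤R-sound (∧-glb p q)             h         = ≤R-sound p h , ≤R-sound q h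
  ≤R-sound ω-top                   h         = tt
  ≤R-sound (ψ⊥≤ω _ _ _)            h         = tt
  ≤R-sound (ω≤ψ⊥ _ _ refl)         h         = bot-least R _
  ≤R-sound (ψ⊔≤ a b _ _ _ _ refl)  h         =
    CompleteLattice.⊑-trans R (x⊑x⊔y R a b) h , CompleteLattice.⊑-trans R (y⊑x⊔y R a b) h
  ≤R-sound (ψ⊔≥ _ _ _ _ _ _ refl)  (ha , hb) = ⊔-least R ha hb

  -- A ρ-type holds of d ∈ D exactly when it holds of every d k, so the rules of
  -- ≤R transfer to D pointwise; this covers R⇒D and the ψ-axioms of ≤D at once.
  ≤R-sound-pointwise : ∀ {ρ ρ'} → _≤R_ M ρ ρ' → ∀ {d} → ⟦_⟧D M (ι M ρ) d → ⟦_⟧D M (ι M ρ') d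
  ≤R-sound-pointwise {ρ} {ρ'} p h = ⟦ι⟧-intro ρ' (λ k → ≤R-sound p (⟦ι⟧-elim ρ h k))

  ≤D-sound : ∀ {δ δ'} → _≤D_ M δ δ' → ∀ {d} → ⟦_⟧D M δ d → ⟦_⟧D M δ' d
  ≤C-sound : ∀ {κ κ'} → _≤C_ M κ κ' → ∀ {k} → ⟦_⟧C M κ k → ⟦_⟧C M κ' k

  ≤D-sound refl                     h         = h
  ≤D-sound (trans p q)              h         = ≤D-sound q (≤D-sound p h)
  ≤D-sound ∧-lb₁                    h         = proj₁ h
  ≤D-sound ∧-lb₂                    h         = proj₂ h
  ≤D-sound (∧-glb p q)              h         = ≤D-sound p h , ≤D-sound q h
  ≤D-sound ω-top                    h         = tt
  ≤D-sound (ψ⊥≤ω c p eq)            h         = ≤R-sound-pointwise (ψ⊥≤ω c p eq) h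
  ≤D-sound (ω≤ψ⊥ c p eq)            h         = ≤R-sound-pointwise (ω≤ψ⊥ c p eq) h
  ≤D-sound (ψ⊔≤ a b c pa pb pc eq)  h         = ≤R-sound-pointwise (ψ⊔≤ a b c pa pb pc eq) h
  ≤D-sound (ψ⊔≥ a b c pa pb pc eq)  h         = ≤R-sound-pointwise (ψ⊔≥ a b c pa pb pc eq) h
  ≤D-sound (R⇒D p)                  h         = ≤R-sound-pointwise p h
  ≤D-sound ω≤ω⇒ω                    h k _     = tt
  ≤D-sound (ψ≤ω⇒ψ _ _)              h k _     = h k
  ≤D-sound (ω⇒ψ≤ψ _ _)              h k       = h k tt
  ≤D-sound ⇒-∧                      (h , h') k hk = h k hk , h' k hk
  ≤D-sound (⇒-mono p q)             h k hk    = ≤R-sound q (h k (≤C-sound p hk))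

  ≤C-sound refl         h                         = h
  ≤C-sound (trans p q)  h                         = ≤C-sound q (≤C-sound p h)
  ≤C-sound ∧-lb₁        h                         = proj₁ h
  ≤C-sound ∧-lb₂        h                         = proj₂ h
  ≤C-sound (∧-glb p q)  h                         = ≤C-sound p h , ≤C-sound q h
  ≤C-sound ω-top        h                         = tt
  ≤C-sound ω≤ω⊗ω        h                         = tt , tt
  ≤C-sound ⊗-∧          ((hd , hk) , (hd' , hk')) = (hd , hd') , (hk , hk')
  ≤C-sound (⊗-mono p q) (hd , hk)                 = ≤D-sound p hd , ≤C-sound q hk

  ⊨-extendᵛ : ∀ {e Γ Δ} x {d} → _⊨_︔_ M e (_∖ᵛ_ M Γ x) Δ → ⟦_⟧D M (Γ x) d →
              _⊨_︔_ M (_[_↦ᵛ_] M e x d) Γ Δ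
  ⊨-extendᵛ {e} {Γ} x (hv , hn) hd = pointwise-update (⟦_⟧D M) Γ (vars e) x hv hd , hn

  ⊨-extendⁿ : ∀ {e Γ Δ} α {k} → _⊨_︔_ M e Γ (_∖ⁿ_ M Δ α) → ⟦_⟧C M (Δ α) k →
              _⊨_︔_ M (_[_↦ⁿ_] M e α k) Γ Δ
  ⊨-extendⁿ {e} {Δ = Δ} α (hv , hn) hk = hv , pointwise-update (⟦_⟧C M) Δ (names e) α hn hk

  module _ (I : Interpretation M) where
    open Interpretation I

    ⟦ƛ⟧-split : ∀ x N e k →
                app (⟦ ƛ x N ⟧t e) k ≡ app (⟦ N ⟧t (_[_↦ᵛ_] M e x (fst k))) (snd k)
    ⟦ƛ⟧-split x N e k =
      subst (λ k' → app (⟦ ƛ x N ⟧t e) k' ≡ app (⟦ N ⟧t (_[_↦ᵛ_] M e x (fst k))) (snd k))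
            (pair-η k) (⟦ƛ⟧ x N e (fst k) (snd k))

    ⊢t-sound : ∀ {Γ N δ Δ} → _⊢t_∶_∣_ M Γ N δ Δ → _⊨t_∶_∣_ M I Γ N δ Δ
    ⊢c-sound : ∀ {Γ c κ Δ} → _⊢c_∶_∣_ M Γ c κ Δ → _⊨c_∶_∣_ M I Γ c κ Δ

    ⊢t-sound (Ax x) e (hv , _) = subst (⟦_⟧D M _) (sym (⟦var⟧ x e)) (hv x)
    ⊢t-sound (Lam {x = x} {N = N} {ρ = ρ} ⊢N) e ⊨e k (hd , hk) =
      subst (⟦_⟧R M ρ) (sym (⟦ƛ⟧-split x N e k))
            (⊢t-sound ⊢N _ (⊨-extendᵛ x ⊨e hd) (snd k) hk)
    ⊢t-sound (App {N = N} {P = P} {ρ = ρ} ⊢N ⊢P) e ⊨e k hk =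
      subst (⟦_⟧R M ρ) (sym (⟦·⟧ N P e k))
            (⊢t-sound ⊢N e ⊨e _ (⟦⊗⟧-pair (⊢t-sound ⊢P e ⊨e) hk))
    ⊢t-sound (Mu {α = α} {c = c} {ρ = ρ} ⊢c) e ⊨e k hk =
      subst (⟦_⟧R M ρ) (sym (⟦μ⟧ α c e k)) (proj₁ ⊨c _ (proj₂ ⊨c))
      where ⊨c = ⊢c-sound ⊢c _ (⊨-extendⁿ α ⊨e hk)
    ⊢t-sound (Meet ⊢₁ ⊢₂) e ⊨e = ⊢t-sound ⊢₁ e ⊨e , ⊢t-sound ⊢₂ e ⊨e
    ⊢t-sound Top e ⊨e = tt
    ⊢t-sound (Sub ⊢N p) e ⊨e = ≤D-sound p (⊢t-sound ⊢N e ⊨e)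

    ⊢c-sound (Com {Δ = Δ} {α = α} {N = N} {δ = δ} ⊢N) e ⊨e =
      subst (⟦_⟧C M (δ ⊗ Δ α)) (sym (⟦cmd⟧ α N e))
            (⟦⊗⟧-pair (⊢t-sound ⊢N e ⊨e) (proj₂ ⊨e α))
    ⊢c-sound (Meet ⊢₁ ⊢₂) e ⊨e = ⊢c-sound ⊢₁ e ⊨e , ⊢c-sound ⊢₂ e ⊨e
    ⊢c-sound Top e ⊨e = tt
    ⊢c-sound (Sub ⊢c p) e ⊨e = ≤C-sound p (⊢c-sound ⊢c e ⊨e)

theorem4p16 : (M : LambdaMuModel) (I : Interpretation M) →
    (∀ Γ N δ Δ → _⊢t_∶_∣_ M Γ N δ Δ → _⊨t_∶_∣_ M I Γ N δ Δ)
    × (∀ Γ c κ Δ → _⊢c_∶_∣_ M Γ c κ Δ → _⊨c_∶_∣_ M I Γ c κ Δ)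
theorem4p16 M I = (λ _ _ _ _ → ⊢t-sound M I) , (λ _ _ _ _ → ⊢c-sound M I)
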